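{- Let $\sigma$ be an address. For all $\mathbf n_\sigma,\mathbf n'_\sigma\in\mathbb Nat=\{\mathbf m_\sigma\mid m\in\mathbb N\}$, if $\kappa_1^-,\kappa_2^-$ are negative actions and $\mathfrak c$ is a sequence of actions with $\mathfrak c\kappa_1^-\in\mathbf n_\sigma$ and $\mathfrak c\kappa_2^-\in\mathbf n'_\sigma$, then $\kappa_1^-=\kappa_2^-$.
   Context: Ludics: actions are $(+,\xi,I)$, $(-,\xi,I)$ (address $\xi$ a finite sequence of naturals, $I$ finite set of naturals) or the positive daimon $\maltese$; a design is a set of chronicles (finite alternating sequences of actions). Naturals as designs: $\overline0=\epsilon$, $\overline{k+1}=\overline k.0.1$; $\mathbf 0_\tau=\{(+,\tau,\emptyset)\}$, $(\mathbf{k+1})_\tau$ the prefix closure of $\{(+,\tau,\{0\})(-,\tau.0,\{1\})\mathfrak c\mid\mathfrak c\in\mathbf k_{\tau.0.1}\}$; so $\mathbf m_\sigma$ has the single maximal chronicle $(+,\sigma,\{0\})(-,\sigma.0,\{1\})\cdots(+,\sigma.\overline m,\emptyset)$. -}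

module Defs where

open import Data.Nat using (ℕ; zero; suc; _<_; z≤n; s≤s)
open import Data.List using (List; []; _∷_; _++_; [_])
open import Data.List.Relation.Unary.Linked using (Linked; []; [-]; _∷_)
open import Data.Product using (Σ; ∃; _×_; _,_)
open import Relation.Binary.PropositionalEquality using (_≡_)

-- Finite sets of naturals, canonically represented as strictly increasing
-- lists (the proof of strictness is irrelevant, so propositional equality of
-- finite sets is equality of their element lists, i.e. set equality).
record FinSetℕ : Set where
  constructor mkSet
  field
    elems : List ℕ
    .strict : Linked _<_ elems

∅ : FinSetℕ
∅ = mkSet [] []

｛_｝ : ℕ → FinSetℕ
｛ n ｝ = mkSet [ n ] [-]

Address : Set
Address = List ℕ

_·_ : Address → ℕ → Address
ξ · i = ξ ++ [ i ]

-- Actions: (+,ξ,I), (-,ξ,I), or the positive daimon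
data Action : Set where
  pos    : Address → FinSetℕ → Action
  neg    : Address → FinSetℕ → Action
  daimon : Action

data Negative : Action → Set where
  neg-is-negative : ∀ ξ I → Negative (neg ξ I)

Seq : Set
Seq = List Action

Design : Set₁
Design = Seq → Set

Prefix : Seq → Seq → Set
Prefix c d = ∃ λ e → c ++ e ≡ d

PrefixClosure : Design → Design
PrefixClosure S c = ∃ λ d → S d × Prefix c d

natDesign : ℕ → Address → Design
natDesign zero    τ c = c ≡ [ pos τ ∅ ]
natDesign (suc k) τ   = PrefixClosure (λ d →
  ∃ λ c' → natDesign k ((τ · 0) · 1) c' ×
           d ≡ pos τ ｛ 0 ｝ ∷ neg (τ · 0) ｛ 1 ｝ ∷ c')

_∈D_ : Seq → Design → Set
c ∈D D = D c

_▹_ : Seq → Action → Seq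
c ▹ κ = c ++ [ κ ]

module Submission where

-- The design 𝐧_σ is the prefix closure of a single chronicle,
--   maximalChronicle n σ = (+,σ,{0}) (-,σ.0,{1}) (+,σ.0.1,{0}) ... (+,σ.n̄,∅),
-- so every chronicle of 𝐧_σ is a prefix of it (natDesign⊆prefixes).  Two such
-- maximal chronicles, for possibly different n and n', follow the same
-- pattern: the actions at odd positions (the negative ones) only depend on σ
-- and on the position, never on n.  Hence if 𝔠κ₁ and 𝔠κ₂ are prefixes of
-- maximalChronicle n σ and maximalChronicle n' σ with κ₁, κ₂ negative, then
-- κ₁ = κ₂ (negative-successor-unique), by induction on 𝔠 two actions at a
-- time.

open import Defs
open import Data.Nat using (ℕ; zero; suc)
open import Data.List using ([]; _∷_; _++_; [_])
open import Data.List.Properties using (++-assoc; ∷-injectiveˡ; ∷-injectiveʳ)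
open import Data.Product using (∃; _,_)
open import Relation.Binary.PropositionalEquality
  using (_≡_; refl; sym; trans; cong; module ≡-Reasoning)

maximalChronicle : ℕ → Address → Seq
maximalChronicle zero    σ = [ pos σ ∅ ]
maximalChronicle (suc k) σ =
  pos σ ｛ 0 ｝ ∷ neg (σ · 0) ｛ 1 ｝ ∷ maximalChronicle k ((σ · 0) · 1)

natDesign⊆prefixes : ∀ n σ c → c ∈D natDesign n σ → Prefix c (maximalChronicle n σ)
natDesign⊆prefixes zero    σ c refl = [] , refl
natDesign⊆prefixes (suc k) σ c (_ , (c' , c'∈𝐤 , refl) , e , c++e≡d)
  with natDesign⊆prefixes k ((σ · 0) · 1) c' c'∈𝐤
... | f , c'++f≡max = e ++ f , (begin
    c ++ (e ++ f)                                ≡⟨ sym (++-assoc c e f) ⟩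
    (c ++ e) ++ f                                ≡⟨ cong (_++ f) c++e≡d ⟩
    pos σ ｛ 0 ｝ ∷ neg (σ · 0) ｛ 1 ｝ ∷ (c' ++ f) ≡⟨ cong (λ s → _ ∷ _ ∷ s) c'++f≡max ⟩
    maximalChronicle (suc k) σ                   ∎)
  where open ≡-Reasoning

▹-prefix : ∀ c κ d → Prefix (c ▹ κ) d → ∃ λ e → c ++ κ ∷ e ≡ d
▹-prefix c κ d (e , c▹κ++e≡d) = e , trans (sym (++-assoc c [ κ ] e)) c▹κ++e≡d

-- Position |𝔠| is
-- odd (even positions hold positive actions); for |𝔠| = 1 both actions are
-- (-,σ.0,{1}), and otherwise we drop the first two actions and recurse at σ.0.1.
negative-successor-unique : ∀ c σ n n' κ₁ κ₂ e₁ e₂ → Negative κ₁ → Negative κ₂ →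
  c ++ κ₁ ∷ e₁ ≡ maximalChronicle n σ → c ++ κ₂ ∷ e₂ ≡ maximalChronicle n' σ →
  κ₁ ≡ κ₂
negative-successor-unique [] σ zero    n' _ _ _ _ () _ refl _
negative-successor-unique [] σ (suc n) n' _ _ _ _ () _ refl _
negative-successor-unique (_ ∷ []) σ zero n' _ _ _ _ _ _ () _
negative-successor-unique (_ ∷ []) σ (suc n) zero _ _ _ _ _ _ _ ()
negative-successor-unique (_ ∷ []) σ (suc n) (suc n') _ _ _ _ _ _ p q =
  trans (∷-injectiveˡ (∷-injectiveʳ p)) (sym (∷-injectiveˡ (∷-injectiveʳ q)))
negative-successor-unique (_ ∷ _ ∷ c) σ zero n' _ _ _ _ _ _ () _
negative-successor-unique (_ ∷ _ ∷ c) σ (suc n) zero _ _ _ _ _ _ _ ()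
negative-successor-unique (_ ∷ _ ∷ c) σ (suc n) (suc n') κ₁ κ₂ e₁ e₂ N₁ N₂ p q =
  negative-successor-unique c ((σ · 0) · 1) n n' κ₁ κ₂ e₁ e₂ N₁ N₂
    (∷-injectiveʳ (∷-injectiveʳ p)) (∷-injectiveʳ (∷-injectiveʳ q))

mainTheorem11 : (σ : Address) (n n' : ℕ) (κ₁ κ₂ : Action) (c : Seq) →
    Negative κ₁ → Negative κ₂ →
    (c ▹ κ₁) ∈D natDesign n σ → (c ▹ κ₂) ∈D natDesign n' σ →
    κ₁ ≡ κ₂
mainTheorem11 σ n n' κ₁ κ₂ c N₁ N₂ c▹κ₁∈𝐧 c▹κ₂∈𝐧'
  with ▹-prefix c κ₁ _ (natDesign⊆prefixes n σ _ c▹κ₁∈𝐧)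
     | ▹-prefix c κ₂ _ (natDesign⊆prefixes n' σ _ c▹κ₂∈𝐧')
... | e₁ , p | e₂ , q = negative-successor-unique c σ n n' κ₁ κ₂ e₁ e₂ N₁ N₂ p q
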